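{- Let $G$ be a connected simple graph. If $\sigma^{ - }(G)=1$, then $\sigma^{ - }(T)=1$ for every spanning tree $T$ of $G$.
   Context: For a connected simple graph $G$ of order $p$, a parity labelling is a bijection $f:V(G)\to\{1,\ldots,p\}$; an edge $uv$ is negative if $f(u),f(v)$ have opposite parity. The rna number $\sigma^{ - }(G)$ is the minimum over all such $f$ of the number of negative edges. -}

module Defs where

open import Data.Nat using (ℕ; zero; suc; _+_; _≤_; _<ᵇ_; _%_)
open import Data.Nat.Properties using ()
open import Data.Bool using (Bool; true; false; _∧_; if_then_else_; not)
open import Data.Fin using (Fin; toℕ; inject₁; fromℕ) renaming (zero to fzero; suc to fsuc)
open import Data.List using (List; map; allFin)
open import Data.Nat.ListAction using (sum)
open import Data.Empty using (⊥)
open import Data.Product using (Σ; _×_; ∃-syntax)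
open import Relation.Binary.PropositionalEquality using (_≡_)
open import Function.Definitions using (Bijective; Injective)

record Graph (p : ℕ) : Set where
  field
    adj    : Fin p → Fin p → Bool
    sym    : ∀ u v → adj u v ≡ adj v u
    irrefl : ∀ u → adj u u ≡ false
open Graph public

data Walk {p : ℕ} (G : Graph p) : Fin p → Fin p → Set where
  here : ∀ {u} → Walk G u u
  step : ∀ {u w v} → adj G u w ≡ true → Walk G w v → Walk G u v

Connected : ∀ {p} → Graph p → Set
Connected G = ∀ u v → Walk G u v

Cycle : ∀ {p} → Graph p → Set
Cycle {p} G =
  Σ ℕ λ k → Σ (Fin (suc (suc (suc k))) → Fin p) λ c →
    Injective _≡_ _≡_ c
    × (∀ (i : Fin (suc (suc k))) → adj G (c (inject₁ i)) (c (fsuc i)) ≡ true)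
    × (adj G (c (fromℕ (suc (suc k)))) (c fzero) ≡ true)

Acyclic : ∀ {p} → Graph p → Set
Acyclic G = Cycle G → ⊥

Tree : ∀ {p} → Graph p → Set
Tree G = Connected G × Acyclic G

SubgraphOf : ∀ {p} → Graph p → Graph p → Set
SubgraphOf T G = ∀ u v → adj T u v ≡ true → adj G u v ≡ true

SpanningTree : ∀ {p} → Graph p → Graph p → Set
SpanningTree T G = SubgraphOf T G × Tree T

-- A parity labelling: a bijection V(G) → {1,…,p}; vertex v gets label
-- suc (toℕ (f v)).
IsLabelling : ∀ {p} → (Fin p → Fin p) → Set
IsLabelling f = Bijective _≡_ _≡_ f

label : ∀ {p} → (Fin p → Fin p) → Fin p → ℕ
label f v = suc (toℕ (f v))

parity : ℕ → ℕ
parity n = n % 2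

differ : ℕ → ℕ → Bool
differ 0 0 = false
differ 0 (suc _) = true
differ (suc _) 0 = true
differ (suc a) (suc b) = differ a b

negInd : ∀ {p} → Graph p → (Fin p → Fin p) → Fin p → Fin p → ℕ
negInd G f u v =
  if (toℕ u <ᵇ toℕ v) ∧ adj G u v ∧ differ (parity (label f u)) (parity (label f v))
  then 1 else 0

-- Number of negative edges (each unordered edge counted once).
negEdges : ∀ {p} → Graph p → (Fin p → Fin p) → ℕ
negEdges {p} G f = sum (map (λ u → sum (map (λ v → negInd G f u v) (allFin p))) (allFin p))

-- σ⁻(G) = k : k is the minimum, over parity labellings f, of negEdges G f.
RnaNumberIs : ∀ {p} → Graph p → ℕ → Set
RnaNumberIs {p} G k =
  (Σ (Fin p → Fin p) λ f → IsLabelling f × negEdges G f ≡ k)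
  × (∀ (f : Fin p → Fin p) → IsLabelling f → k ≤ negEdges G f)

-- Under any parity labelling of a connected graph on p ≥ 2 vertices, a walk
-- from the vertex labelled 1 to the vertex labelled 2 must cross an edge whose
-- ends have opposite parity, so σ⁻ ≥ 1. Deleting edges never creates negative
-- edges, so a labelling of G with one negative edge has at most one on a
-- spanning tree T, hence exactly one, and σ⁻(T) = 1. For p ≤ 1 there are no
-- edges, so σ⁻(G) = 1 cannot hold.
module Submission where

open import Defs hiding (sym)
open import Data.Nat using (ℕ; zero; suc; _≤_; _<_; _<ᵇ_; z≤n)
open import Data.Bool using (true; false)
open import Data.Nat.Properties
  using (≤-refl; ≤-trans; ≤-antisym; +-mono-≤; m≤m+n; m≤n+m; <⇒<ᵇ; <-cmp)
open import Data.Bool.Properties using (T-≡)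
open import Data.Fin using (Fin; toℕ) renaming (zero to fzero; suc to fsuc)
open import Data.Fin.Properties using (toℕ-injective)
open import Data.List using (List; []; _∷_; map; allFin)
open import Data.List.Relation.Unary.Any using (here; there)
open import Data.List.Membership.Propositional using (_∈_)
open import Data.List.Membership.Propositional.Properties using (∈-allFin)
open import Data.Nat.ListAction using (sum)
open import Data.Empty using (⊥-elim)
open import Data.Product using (_×_; _,_; proj₁; proj₂; ∃-syntax)
open import Function using (_∘_; Equivalence)
open import Relation.Binary using (tri<; tri≈; tri>)
open import Relation.Binary.PropositionalEquality
  using (_≡_; _≢_; refl; sym; trans; cong; subst)

sum-map-mono : ∀ {A : Set} {g h : A → ℕ} → (∀ x → g x ≤ h x) →
  ∀ xs → sum (map g xs) ≤ sum (map h xs)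
sum-map-mono g≤h []       = z≤n
sum-map-mono g≤h (x ∷ xs) = +-mono-≤ (g≤h x) (sum-map-mono g≤h xs)

∈⇒≤sum-map : ∀ {A : Set} (g : A → ℕ) {x : A} {xs : List A} → x ∈ xs → g x ≤ sum (map g xs)
∈⇒≤sum-map g {xs = y ∷ ys} (here refl) = m≤m+n (g y) _
∈⇒≤sum-map g {xs = y ∷ ys} (there x∈) = ≤-trans (∈⇒≤sum-map g x∈) (m≤n+m _ (g y))

differ≡false⇒≡ : ∀ a b → differ a b ≡ false → a ≡ b
differ≡false⇒≡ zero    zero    _  = refl
differ≡false⇒≡ (suc a) (suc b) eq = cong suc (differ≡false⇒≡ a b eq)

differ-sym : ∀ a b → differ a b ≡ differ b a
differ-sym zero    zero    = refl
differ-sym zero    (suc b) = refl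
differ-sym (suc a) zero    = refl
differ-sym (suc a) (suc b) = differ-sym a b

module _ {p : ℕ} where

  negInd-mono : {H G : Graph p} → SubgraphOf H G → ∀ f u v → negInd H f u v ≤ negInd G f u v
  negInd-mono {H} {G} H⊆G f u v with toℕ u <ᵇ toℕ v
  ... | false = z≤n
  ... | true with adj H u v in uv∈H
  ...   | false = z≤n
  ...   | true rewrite H⊆G u v uv∈H = ≤-refl

  negEdges-mono : {H G : Graph p} → SubgraphOf H G → ∀ f → negEdges H f ≤ negEdges G f
  negEdges-mono {H} {G} H⊆G f =
    sum-map-mono (λ u → sum-map-mono (negInd-mono {H} {G} H⊆G f u) (allFin p)) (allFin p)

  DichromaticEdge : Graph p → (Fin p → ℕ) → Set
  DichromaticEdge G c = ∃[ a ] ∃[ b ] adj G a b ≡ true × differ (c a) (c b) ≡ true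

  walk⇒dichromaticEdge : ∀ {G : Graph p} (c : Fin p → ℕ) {u v} →
    Walk G u v → c u ≢ c v → DichromaticEdge G c
  walk⇒dichromaticEdge c here cu≢cv = ⊥-elim (cu≢cv refl)
  walk⇒dichromaticEdge c {u} (step {w = w} uw rest) cu≢cv with differ (c u) (c w) in cu-cw
  ... | true  = u , w , uw , cu-cw
  ... | false = walk⇒dichromaticEdge c rest (cu≢cv ∘ trans (differ≡false⇒≡ _ _ cu-cw))

  negInd≤negEdges : ∀ (G : Graph p) f a b → negInd G f a b ≤ negEdges G f
  negInd≤negEdges G f a b =
    ≤-trans (∈⇒≤sum-map (negInd G f a) (∈-allFin b))
            (∈⇒≤sum-map (λ u → sum (map (negInd G f u) (allFin p))) (∈-allFin a))

  <-negativeEdge⇒1≤negEdges : ∀ (G : Graph p) f {a b} → toℕ a < toℕ b → adj G a b ≡ true →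
    differ (parity (label f a)) (parity (label f b)) ≡ true → 1 ≤ negEdges G f
  <-negativeEdge⇒1≤negEdges G f {a} {b} a<b ab∈G ab-neg =
    subst (_≤ negEdges G f) negInd≡1 (negInd≤negEdges G f a b)
    where
    negInd≡1 : negInd G f a b ≡ 1
    negInd≡1 rewrite Equivalence.to T-≡ (<⇒<ᵇ a<b) | ab∈G | ab-neg = refl

  negativeEdge⇒1≤negEdges : ∀ (G : Graph p) f →
    DichromaticEdge G (parity ∘ label f) → 1 ≤ negEdges G f
  negativeEdge⇒1≤negEdges G f (a , b , ab∈G , ab-neg) with <-cmp (toℕ a) (toℕ b)
  ... | tri< a<b _ _ = <-negativeEdge⇒1≤negEdges G f a<b ab∈G ab-neg
  ... | tri> _ _ b<a = <-negativeEdge⇒1≤negEdges G f b<a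
    (trans (Graph.sym G b a) ab∈G)
    (trans (differ-sym (parity (label f b)) (parity (label f a))) ab-neg)
  ... | tri≈ _ a≡b _ with toℕ-injective a≡b
  ...   | refl with trans (sym (irrefl G a)) ab∈G
  ...     | ()

connected⇒1≤negEdges : ∀ {q} {G : Graph (suc (suc q))} → Connected G →
  ∀ f → IsLabelling f → 1 ≤ negEdges G f
connected⇒1≤negEdges {q} {G} connected f (_ , f-surjective) =
  negativeEdge⇒1≤negEdges G f
    (walk⇒dichromaticEdge (parity ∘ label f) (connected labelled1 labelled2) parities-differ)
  where
  labelled1 labelled2 : Fin (suc (suc q))
  labelled1 = proj₁ (f-surjective fzero)
  labelled2 = proj₁ (f-surjective (fsuc fzero))
  parities-differ : parity (label f labelled1) ≢ parity (label f labelled2)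
  parities-differ
    rewrite proj₂ (f-surjective fzero) refl | proj₂ (f-surjective (fsuc fzero)) refl = λ ()

negEdges≡1⇒rnaNumber≡1 : ∀ {q} {G : Graph (suc (suc q))} → Connected G →
  ∀ f → IsLabelling f → negEdges G f ≡ 1 → RnaNumberIs G 1
negEdges≡1⇒rnaNumber≡1 connected f f-labelling negEdges≡1 =
  (f , f-labelling , negEdges≡1) , connected⇒1≤negEdges connected

mainTheorem10 : ∀ {p : ℕ} (G : Graph p) → Connected G → RnaNumberIs G 1 →
    ∀ (T : Graph p) → SpanningTree T G → RnaNumberIs T 1
mainTheorem10 {zero}        G _ ((_ , _ , ()) , _)
mainTheorem10 {suc zero}    G _ ((_ , _ , ()) , _)
mainTheorem10 {suc (suc q)} G _ ((f , f-labelling , negG≡1) , _) T (T⊆G , T-connected , _) =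
  negEdges≡1⇒rnaNumber≡1 T-connected f f-labelling
    (≤-antisym (subst (negEdges T f ≤_) negG≡1 (negEdges-mono {H = T} {G} T⊆G f))
               (connected⇒1≤negEdges T-connected f f-labelling))
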